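{- Let $d,m,n$ be positive integers with $d\mid m$. Then $P(d,n)$ divides $P(m,n)$.
   Context: For positive integers $m,n$, let $\mathbf{Z}_m$ be the ring of integers modulo $m$ and define $T:\mathbf{Z}_m^n\to\mathbf{Z}_m^n$ by $T(a_0,\dots,a_{n-1})=(a_0+a_1,a_1+a_2,\dots,a_{n-2}+a_{n-1},a_{n-1}+a_0)$. For $\mathbf{a}\in\mathbf{Z}_m^n$, the cycle length of $(T^k\mathbf{a})_{k\ge0}$ is the smallest positive integer $P$ for which there exists $N$ with $T^{k+P}\mathbf{a}=T^k\mathbf{a}$ for all $k\ge N$. The period $P(m,n)$ is the maximum of these cycle lengths over all $\mathbf{a}\in\mathbf{Z}_m^n$. -}

module Defs where

open import Data.Nat using (ℕ; zero; suc; _+_; _≤_; _<_; NonZero)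
open import Data.Nat.DivMod using (_mod_)
open import Data.Fin using (Fin; toℕ)
open import Data.Vec using (Vec; tabulate; lookup)
open import Data.Product using (Σ; ∃; _×_)
open import Relation.Binary.PropositionalEquality using (_≡_)

-- Z_m is represented by Fin m, with addition modulo m.

addMod : (m : ℕ) .{{_ : NonZero m}} → Fin m → Fin m → Fin m
addMod m x y = (toℕ x + toℕ y) mod m

nextIdx : (n : ℕ) .{{_ : NonZero n}} → Fin n → Fin n
nextIdx n i = suc (toℕ i) mod n

T : (m n : ℕ) .{{_ : NonZero m}} .{{_ : NonZero n}} → Vec (Fin m) n → Vec (Fin m) n
T m n a = tabulate (λ i → addMod m (lookup a i) (lookup a (nextIdx n i)))

iterT : (m n : ℕ) .{{_ : NonZero m}} .{{_ : NonZero n}} → ℕ → Vec (Fin m) n → Vec (Fin m) n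
iterT m n zero    a = a
iterT m n (suc k) a = T m n (iterT m n k a)

EventuallyPeriodicWith : (m n : ℕ) .{{_ : NonZero m}} .{{_ : NonZero n}} →
                         Vec (Fin m) n → ℕ → Set
EventuallyPeriodicWith m n a P =
  ∃ λ N → ∀ k → N ≤ k → iterT m n (k + P) a ≡ iterT m n k a

IsCycleLength : (m n : ℕ) .{{_ : NonZero m}} .{{_ : NonZero n}} →
                Vec (Fin m) n → ℕ → Set
IsCycleLength m n a P =
  0 < P × EventuallyPeriodicWith m n a P ×
  (∀ Q → 0 < Q → EventuallyPeriodicWith m n a Q → P ≤ Q)

-- p is the period P(m,n): the maximum of the cycle lengths over all a
IsPeriod : (m n : ℕ) .{{_ : NonZero m}} .{{_ : NonZero n}} → ℕ → Set
IsPeriod m n p =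
  (∃ λ a → IsCycleLength m n a p) ×
  (∀ a Q → IsCycleLength m n a Q → Q ≤ p)

{-# OPTIONS --safe #-}
-- Write m = c d. Multiplication by c embeds Z_d into Z_m compatibly with T, and the orbit of
-- a ∈ Z_d^n is eventually Q-periodic iff the orbit of c a is, so P(d,n) is the cycle length of
-- a vector of Z_m^n. Since T is linear and commutes with the cyclic shift, every vector is a
-- linear combination of shifts of the unit vector e = (0,…,0,1); hence the cycle length of e
-- is an eventual period of every orbit. So it equals P(m,n), and every cycle length in Z_m^n,
-- in particular P(d,n), divides P(m,n).
module Submission where

open import Algebra.Properties.CommutativeSemigroup using (interchange)
open import Data.Fin using (Fin; toℕ; funToFin; finToFun)
open import Data.Fin.Properties using (toℕ-injective; toℕ<n; toℕ-fromℕ<; pigeonhole; finToFun-funToFin)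
  renaming (_≟_ to _≟ᶠ_)
open import Data.Nat
open import Data.Nat.DivMod
open import Data.Nat.Divisibility using (_∣_; divides; ∣⇒≤; m%n≡0⇒n∣m)
open import Data.Nat.Induction using (<-rec)
open import Data.Nat.Properties
open import Data.Product using (∃; ∃₂; _×_; _,_; proj₁; proj₂)
open import Data.Sum using (inj₁; inj₂)
open import Data.Vec using (Vec; tabulate; lookup)
open import Data.Vec.Properties using (lookup∘tabulate; tabulate∘lookup; tabulate-cong; ≡-dec)
open import Function.Base using (_∘′_)
open import Function.Bundles using (_⇔_; mk⇔; Equivalence)
open import Function.Construct.Composition using (_⇔-∘_)
open import Function.Construct.Symmetry using (⇔-sym)
open import Relation.Binary.Definitions using (DecidableEquality)
open import Relation.Binary.PropositionalEquality
open import Relation.Nullary using (Dec; yes; no; contradiction)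
open import Relation.Nullary.Decidable using (_×-dec_)

open import Defs

open Equivalence using (to; from)

IsLeastPositive : (ℕ → Set) → ℕ → Set
IsLeastPositive P x = 0 < x × P x × (∀ y → 0 < y → P y → x ≤ y)

leastPositive-exists : ∀ {P : ℕ → Set} → (∀ x → Dec (P x)) →
                       ∀ x → 0 < x → P x → ∃ (IsLeastPositive P)
leastPositive-exists {P} P? = <-rec _ search
  where
  search : ∀ x → (∀ {y} → y < x → 0 < y → P y → ∃ (IsLeastPositive P)) →
           0 < x → P x → ∃ (IsLeastPositive P)
  search x smaller 0<x px with anyUpTo? (λ y → 0 <? y ×-dec P? y) x
  ... | yes (y , y<x , 0<y , py) = smaller y<x 0<y py
  ... | no ∄smaller = x , 0<x , px , λ y 0<y py → ≮⇒≥ (λ y<x → ∄smaller (y , y<x , 0<y , py))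

isLeastPositive-⇔ : ∀ {P Q : ℕ → Set} → (∀ y → P y ⇔ Q y) →
                    ∀ {x} → IsLeastPositive P x → IsLeastPositive Q x
isLeastPositive-⇔ P⇔Q (0<x , px , least) =
  0<x , to (P⇔Q _) px , λ y 0<y qy → least y 0<y (from (P⇔Q y) qy)

module _ {X : Set} (s : ℕ → X) where

  PeriodicFrom : ℕ → ℕ → Set
  PeriodicFrom N Q = ∀ k → N ≤ k → s (k + Q) ≡ s k

  EventuallyPeriodic : ℕ → Set
  EventuallyPeriodic Q = ∃ λ N → PeriodicFrom N Q

  periodicFrom-* : ∀ {N Q} → PeriodicFrom N Q → ∀ j → PeriodicFrom N (j * Q)
  periodicFrom-* per zero    k N≤k = cong s (+-identityʳ k)
  periodicFrom-* {Q = Q} per (suc j) k N≤k = begin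
    s (k + (Q + j * Q)) ≡⟨ cong s (trans (cong (k +_) (+-comm Q (j * Q))) (sym (+-assoc k (j * Q) Q))) ⟩
    s (k + j * Q + Q)   ≡⟨ per (k + j * Q) (≤-trans N≤k (m≤m+n k (j * Q))) ⟩
    s (k + j * Q)       ≡⟨ periodicFrom-* per j k N≤k ⟩
    s k                 ∎
    where open ≡-Reasoning

  leastPeriod∣period : ∀ {P Q} → IsLeastPositive EventuallyPeriodic P →
                       EventuallyPeriodic Q → P ∣ Q
  leastPeriod∣period {P} {Q} (0<P , (N₁ , per₁) , least) (N₂ , per₂) =
    m%n≡0⇒n∣m Q P remainder≡0
    where
    instance
      P≢0 : NonZero P
      P≢0 = >-nonZero 0<P

    remainder-period : EventuallyPeriodic (Q % P)
    remainder-period = N₁ + N₂ , λ k N≤k → begin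
      s (k + Q % P)              ≡⟨ periodicFrom-* per₁ (Q / P) (k + Q % P) (≤-trans (m≤m+n N₁ N₂) (≤-trans N≤k (m≤m+n k _))) ⟨
      s (k + Q % P + Q / P * P)  ≡⟨ cong s (trans (+-assoc k _ _) (cong (k +_) (sym (m≡m%n+[m/n]*n Q P)))) ⟩
      s (k + Q)                  ≡⟨ per₂ k (≤-trans (m≤n+m N₂ N₁) N≤k) ⟩
      s k                        ∎
      where open ≡-Reasoning

    remainder≡0 : Q % P ≡ 0
    remainder≡0 with Q % P ≟ 0
    ... | yes r≡0 = r≡0
    ... | no  r≢0 = contradiction (least _ (n≢0⇒n>0 r≢0) remainder-period) (<⇒≱ (m%n<n Q P))

  eventuallyPeriodic⇒repeats : ∀ {N Q₀ Q} → 0 < Q₀ → PeriodicFrom N Q₀ →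
                               EventuallyPeriodic Q → s (N + Q) ≡ s N
  eventuallyPeriodic⇒repeats {N} {Q₀} {Q} 0<Q₀ per₀ (M , per) = begin
    s (N + Q)              ≡⟨ periodicFrom-* per₀ M (N + Q) (m≤m+n N Q) ⟨
    s (N + Q + M * Q₀)     ≡⟨ cong s (trans (+-assoc N Q _) (trans (cong (N +_) (+-comm Q _)) (sym (+-assoc N _ Q)))) ⟩
    s (N + M * Q₀ + Q)     ≡⟨ per (N + M * Q₀) (≤-trans (m≤m*n M Q₀) (m≤n+m _ N)) ⟩
    s (N + M * Q₀)         ≡⟨ periodicFrom-* per₀ M N ≤-refl ⟩
    s N                    ∎
    where
    open ≡-Reasoning
    instance
      Q₀≢0 : NonZero Q₀
      Q₀≢0 = >-nonZero 0<Q₀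

module _ {X : Set} (g : X → X) (s : ℕ → X) (s-suc : ∀ k → s (suc k) ≡ g (s k)) where

  repeat-persists : ∀ {N Q} → s (N + Q) ≡ s N → ∀ {k} → N ≤′ k → s (k + Q) ≡ s k
  repeat-persists repeat ≤′-refl = repeat
  repeat-persists {Q = Q} repeat (≤′-step {k} N≤′k) = begin
    s (suc k + Q) ≡⟨ s-suc (k + Q) ⟩
    g (s (k + Q)) ≡⟨ cong g (repeat-persists repeat N≤′k) ⟩
    g (s k)       ≡⟨ s-suc k ⟨
    s (suc k)     ∎
    where open ≡-Reasoning

  repeat⇒periodicFrom : ∀ {N Q} → s (N + Q) ≡ s N → PeriodicFrom s N Q
  repeat⇒periodicFrom repeat k N≤k = repeat-persists repeat (≤⇒≤′ N≤k)

  leastPeriod-exists : DecidableEquality X → ∀ {N Q₀} → 0 < Q₀ → s (N + Q₀) ≡ s N →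
                       ∃ (IsLeastPositive (EventuallyPeriodic s))
  leastPeriod-exists _≟ₓ_ {N} 0<Q₀ repeat
    with R , 0<R , repeatR , least ← leastPositive-exists (λ Q → s (N + Q) ≟ₓ s N) _ 0<Q₀ repeat =
    R , 0<R , (N , repeat⇒periodicFrom repeatR) , λ Q 0<Q perQ →
      least Q 0<Q (eventuallyPeriodic⇒repeats s 0<Q₀ (repeat⇒periodicFrom repeat) perQ)

step : (ℕ → ℕ) → ℕ → ℕ
step f i = f i + f (suc i)

iterStep : ℕ → (ℕ → ℕ) → ℕ → ℕ
iterStep zero    f = f
iterStep (suc k) f = step (iterStep k f)

iterStep-+ : ∀ k f g i → iterStep k (λ j → f j + g j) i ≡ iterStep k f i + iterStep k g i
iterStep-+ zero    f g i = refl
iterStep-+ (suc k) f g i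
  rewrite iterStep-+ k f g i | iterStep-+ k f g (suc i) =
  interchange +-commutativeSemigroup (iterStep k f i) (iterStep k g i) (iterStep k f (suc i)) (iterStep k g (suc i))

iterStep-* : ∀ k c f i → iterStep k (λ j → c * f j) i ≡ c * iterStep k f i
iterStep-* zero    c f i = refl
iterStep-* (suc k) c f i
  rewrite iterStep-* k c f i | iterStep-* k c f (suc i) = sym (*-distribˡ-+ c _ _)

iterStep-suc : ∀ k f i → iterStep k (λ j → f (suc j)) i ≡ iterStep k f (suc i)
iterStep-suc zero    f i = refl
iterStep-suc (suc k) f i = cong₂ _+_ (iterStep-suc k f i) (iterStep-suc k f (suc i))

iterStep-0 : ∀ k i → iterStep k (λ _ → 0) i ≡ 0
iterStep-0 zero    i = refl
iterStep-0 (suc k) i rewrite iterStep-0 k i | iterStep-0 k (suc i) = refl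

module _ (M : ℕ) .{{_ : NonZero M}} where

  _≈_ : (ℕ → ℕ) → (ℕ → ℕ) → Set
  f ≈ g = ∀ i → f i % M ≡ g i % M

  EventuallyPeriodicMod : ℕ → (ℕ → ℕ) → Set
  EventuallyPeriodicMod Q f = ∃ λ N → ∀ k → N ≤ k → iterStep (k + Q) f ≈ iterStep k f

  %-cong-+ : ∀ {a b c d} → a % M ≡ c % M → b % M ≡ d % M → (a + b) % M ≡ (c + d) % M
  %-cong-+ {a} {b} {c} {d} a≡c b≡d = begin
    (a + b) % M             ≡⟨ %-distribˡ-+ a b M ⟩
    (a % M + b % M) % M     ≡⟨ cong₂ (λ x y → (x + y) % M) a≡c b≡d ⟩
    (c % M + d % M) % M     ≡⟨ %-distribˡ-+ c d M ⟨
    (c + d) % M             ∎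
    where open ≡-Reasoning

  %-cong-*ˡ : ∀ c {a b} → a % M ≡ b % M → (c * a) % M ≡ (c * b) % M
  %-cong-*ˡ c {a} {b} a≡b = begin
    (c * a) % M             ≡⟨ %-distribˡ-* c a M ⟩
    (c % M * (a % M)) % M   ≡⟨ cong (λ x → (c % M * x) % M) a≡b ⟩
    (c % M * (b % M)) % M   ≡⟨ %-distribˡ-* c b M ⟨
    (c * b) % M             ∎
    where open ≡-Reasoning

  iterStep-≈ : ∀ k {f g} → f ≈ g → iterStep k f ≈ iterStep k g
  iterStep-≈ zero    f≈g = f≈g
  iterStep-≈ (suc k) f≈g i = %-cong-+ (iterStep-≈ k f≈g i) (iterStep-≈ k f≈g (suc i))

  eventuallyPeriodicMod-≈ : ∀ {Q f g} → f ≈ g → EventuallyPeriodicMod Q f → EventuallyPeriodicMod Q g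
  eventuallyPeriodicMod-≈ {Q} f≈g (N , per) = N , λ k N≤k i →
    trans (sym (iterStep-≈ (k + Q) f≈g i)) (trans (per k N≤k i) (iterStep-≈ k f≈g i))

  eventuallyPeriodicMod-+ : ∀ {Q f g} → EventuallyPeriodicMod Q f → EventuallyPeriodicMod Q g →
                            EventuallyPeriodicMod Q (λ j → f j + g j)
  eventuallyPeriodicMod-+ {Q} {f} {g} (N₁ , per₁) (N₂ , per₂) = N₁ ⊔ N₂ , λ k N≤k i → begin
    iterStep (k + Q) (λ j → f j + g j) i % M         ≡⟨ cong (_% M) (iterStep-+ (k + Q) f g i) ⟩
    (iterStep (k + Q) f i + iterStep (k + Q) g i) % M
      ≡⟨ %-cong-+ (per₁ k (m⊔n≤o⇒m≤o N₁ N₂ N≤k) i) (per₂ k (m⊔n≤o⇒n≤o N₁ N₂ N≤k) i) ⟩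
    (iterStep k f i + iterStep k g i) % M             ≡⟨ cong (_% M) (iterStep-+ k f g i) ⟨
    iterStep k (λ j → f j + g j) i % M               ∎
    where open ≡-Reasoning

  eventuallyPeriodicMod-* : ∀ {Q f} c → EventuallyPeriodicMod Q f →
                            EventuallyPeriodicMod Q (λ j → c * f j)
  eventuallyPeriodicMod-* {Q} {f} c (N , per) = N , λ k N≤k i → begin
    iterStep (k + Q) (λ j → c * f j) i % M   ≡⟨ cong (_% M) (iterStep-* (k + Q) c f i) ⟩
    (c * iterStep (k + Q) f i) % M           ≡⟨ %-cong-*ˡ c (per k N≤k i) ⟩
    (c * iterStep k f i) % M                 ≡⟨ cong (_% M) (iterStep-* k c f i) ⟨
    iterStep k (λ j → c * f j) i % M         ∎
    where open ≡-Reasoning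

  eventuallyPeriodicMod-suc : ∀ {Q f} → EventuallyPeriodicMod Q f →
                              EventuallyPeriodicMod Q (λ j → f (suc j))
  eventuallyPeriodicMod-suc {Q} {f} (N , per) = N , λ k N≤k i → begin
    iterStep (k + Q) (λ j → f (suc j)) i % M ≡⟨ cong (_% M) (iterStep-suc (k + Q) f i) ⟩
    iterStep (k + Q) f (suc i) % M           ≡⟨ per k N≤k (suc i) ⟩
    iterStep k f (suc i) % M                 ≡⟨ cong (_% M) (iterStep-suc k f i) ⟨
    iterStep k (λ j → f (suc j)) i % M       ∎
    where open ≡-Reasoning

  eventuallyPeriodicMod-0 : ∀ {Q} → EventuallyPeriodicMod Q (λ _ → 0)
  eventuallyPeriodicMod-0 {Q} = 0 , λ k _ i → cong (_% M) (trans (iterStep-0 (k + Q) i) (sym (iterStep-0 k i)))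

indicator : {A : Set} → Dec A → ℕ
indicator (yes _) = 1
indicator (no _)  = 0

module _ (n : ℕ) .{{_ : NonZero n}} where

  Periodic : (ℕ → ℕ) → Set
  Periodic f = ∀ i → f (i % n) ≡ f i

  δ : ℕ → ℕ → ℕ
  δ t i = indicator (i % n ≟ t)

  δ-periodic : ∀ t → Periodic (δ t)
  δ-periodic t i = cong (λ r → indicator (r ≟ t)) (m%n%n≡m%n i n)

  suc-% : ∀ i → suc i % n ≡ suc (i % n) % n
  suc-% i = trans (cong (λ x → suc x % n) (m≡m%n+[m/n]*n i n)) ([m+kn]%n≡m%n (suc (i % n)) (i / n) n)

  %≡⇔suc-%≡ : ∀ {t} → suc t < n → ∀ i → i % n ≡ t ⇔ suc i % n ≡ suc t
  %≡⇔suc-%≡ {t} 1+t<n i = mk⇔ to′ from′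
    where
    to′ : i % n ≡ t → suc i % n ≡ suc t
    to′ refl = trans (suc-% i) (m<n⇒m%n≡m 1+t<n)
    from′ : suc i % n ≡ suc t → i % n ≡ t
    from′ eq with m≤n⇒m<n∨m≡n (m%n<n i n)
    ... | inj₁ 1+r<n = suc-injective (trans (sym (m<n⇒m%n≡m 1+r<n)) (trans (sym (suc-% i)) eq))
    ... | inj₂ 1+r≡n = contradiction (trans (sym eq) (trans (suc-% i) (trans (cong (_% n) 1+r≡n) (n%n≡0 n)))) 1+n≢0

  δ-suc : ∀ {t} → suc t < n → ∀ i → δ t i ≡ δ (suc t) (suc i)
  δ-suc {t} 1+t<n i with i % n ≟ t | suc i % n ≟ suc t
  ... | yes _ | yes _ = refl
  ... | no  _ | no  _ = refl
  ... | yes r≡t | no r′≢1+t = contradiction (to (%≡⇔suc-%≡ 1+t<n i) r≡t) r′≢1+t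
  ... | no  r≢t | yes r′≡1+t = contradiction (from (%≡⇔suc-%≡ 1+t<n i) r′≡1+t) r≢t

  indicatorSum : (ℕ → ℕ) → ℕ → ℕ → ℕ
  indicatorSum F zero    i = 0
  indicatorSum F (suc t) i = indicatorSum F t i + F t * δ t i

  indicatorSum-vanishes : ∀ F t i → t ≤ i % n → indicatorSum F t i ≡ 0
  indicatorSum-vanishes F zero    i _ = refl
  indicatorSum-vanishes F (suc t) i 1+t≤r with i % n ≟ t
  ... | yes r≡t = contradiction 1+t≤r (<-irrefl (sym r≡t))
  ... | no  _   rewrite indicatorSum-vanishes F t i (<⇒≤ 1+t≤r) | *-zeroʳ (F t) = refl

  indicatorSum-selects : ∀ F t i → i % n < t → indicatorSum F t i ≡ F (i % n)
  indicatorSum-selects F (suc t) i r<1+t with i % n ≟ t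
  ... | yes r≡t rewrite indicatorSum-vanishes F t i (≤-reflexive (sym r≡t)) | *-identityʳ (F t) = cong F (sym r≡t)
  ... | no  r≢t rewrite *-zeroʳ (F t) | +-identityʳ (indicatorSum F t i) =
    indicatorSum-selects F t i (≤∧≢⇒< (s≤s⁻¹ r<1+t) r≢t)

  module _ (M : ℕ) .{{_ : NonZero M}} {Q : ℕ} (δ-last : EventuallyPeriodicMod M Q (δ (pred n))) where

    eventuallyPeriodicMod-δ : ∀ t j → t + j ≡ pred n → EventuallyPeriodicMod M Q (δ t)
    eventuallyPeriodicMod-δ t zero    t+0≡pred[n] rewrite +-identityʳ t | t+0≡pred[n] = δ-last
    eventuallyPeriodicMod-δ t (suc j) t+1+j≡pred[n] =
      eventuallyPeriodicMod-≈ M (λ i → cong (_% M) (sym (δ-suc 1+t<n i)))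
        (eventuallyPeriodicMod-suc M (eventuallyPeriodicMod-δ (suc t) j (trans (sym (+-suc t j)) t+1+j≡pred[n])))
      where
      1+t<n : suc t < n
      1+t<n = m≤pred[n]⇒suc[m]≤n (≤-trans (m≤m+n (suc t) j) (≤-reflexive (trans (sym (+-suc t j)) t+1+j≡pred[n])))

    eventuallyPeriodicMod-indicatorSum : ∀ F t → t ≤ n → EventuallyPeriodicMod M Q (indicatorSum F t)
    eventuallyPeriodicMod-indicatorSum F zero    _     = eventuallyPeriodicMod-0 M
    eventuallyPeriodicMod-indicatorSum F (suc t) 1+t≤n =
      eventuallyPeriodicMod-+ M (eventuallyPeriodicMod-indicatorSum F t (<⇒≤ 1+t≤n))
        (eventuallyPeriodicMod-* M (F t) (eventuallyPeriodicMod-δ t (pred n ∸ t) (m+[n∸m]≡n (suc[m]≤n⇒m≤pred[n] 1+t≤n))))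

    δ-last-universal : ∀ {f} → Periodic f → EventuallyPeriodicMod M Q f
    δ-last-universal {f} f-periodic = eventuallyPeriodicMod-≈ M
      (λ i → cong (_% M) (trans (indicatorSum-selects f n i (m%n<n i n)) (f-periodic i)))
      (eventuallyPeriodicMod-indicatorSum f n ≤-refl)

toℕ-mod : ∀ i n .{{_ : NonZero n}} → toℕ (i mod n) ≡ i % n
toℕ-mod i n = toℕ-fromℕ< (m%n<n i n)

toℕ-mod-id : ∀ {n} .{{_ : NonZero n}} (j : Fin n) → toℕ j mod n ≡ j
toℕ-mod-id {n} j = toℕ-injective (trans (toℕ-mod (toℕ j) n) (m<n⇒m%n≡m (toℕ<n j)))

lookup-extensional : ∀ {A : Set} {n} {u v : Vec A n} → (∀ j → lookup u j ≡ lookup v j) → u ≡ v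
lookup-extensional {u = u} {v} u≗v = trans (sym (tabulate∘lookup u)) (trans (tabulate-cong u≗v) (tabulate∘lookup v))

module _ (m n : ℕ) .{{_ : NonZero m}} .{{_ : NonZero n}} where

  -- A vector is modelled by an n-periodic sequence read mod m; on sequences T becomes the
  -- linear map step, with no wrap-around and no reduction mod m.
  Represents : Vec (Fin m) n → (ℕ → ℕ) → Set
  Represents a f = ∀ i → toℕ (lookup a (i mod n)) ≡ f i % m

  nextIdx-mod : ∀ i → nextIdx n (i mod n) ≡ suc i mod n
  nextIdx-mod i = toℕ-injective (begin
    toℕ (suc (toℕ (i mod n)) mod n) ≡⟨ toℕ-mod _ n ⟩
    suc (toℕ (i mod n)) % n         ≡⟨ cong (λ r → suc r % n) (toℕ-mod i n) ⟩
    suc (i % n) % n                 ≡⟨ suc-% n i ⟨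
    suc i % n                       ≡⟨ toℕ-mod (suc i) n ⟨
    toℕ (suc i mod n)               ∎)
    where open ≡-Reasoning

  T-represents : ∀ {a f} → Represents a f → Represents (T m n a) (step f)
  T-represents {a} {f} a~f i = begin
    toℕ (lookup (T m n a) (i mod n))
      ≡⟨ cong toℕ (lookup∘tabulate _ (i mod n)) ⟩
    toℕ (addMod m (lookup a (i mod n)) (lookup a (nextIdx n (i mod n))))
      ≡⟨ toℕ-mod _ m ⟩
    (toℕ (lookup a (i mod n)) + toℕ (lookup a (nextIdx n (i mod n)))) % m
      ≡⟨ cong₂ (λ x y → (x + y) % m) (a~f i) (trans (cong (toℕ ∘′ lookup a) (nextIdx-mod i)) (a~f (suc i))) ⟩
    (f i % m + f (suc i) % m) % m
      ≡⟨ %-distribˡ-+ (f i) (f (suc i)) m ⟨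
    step f i % m ∎
    where open ≡-Reasoning

  iterT-represents : ∀ {a f} → Represents a f → ∀ k → Represents (iterT m n k a) (iterStep k f)
  iterT-represents a~f zero    = a~f
  iterT-represents {a} {f} a~f (suc k) = T-represents {iterT m n k a} {iterStep k f} (iterT-represents a~f k)

  represents-≡⇔≈ : ∀ {a b f g} → Represents a f → Represents b g → (a ≡ b) ⇔ (_≈_ m f g)
  represents-≡⇔≈ {a} {b} {f} {g} a~f b~g = mk⇔ (λ { refl i → trans (sym (a~f i)) (b~g i) }) from′
    where
    from′ : _≈_ m f g → a ≡ b
    from′ f≈g = lookup-extensional λ j → toℕ-injective (begin
      toℕ (lookup a j)                ≡⟨ cong (toℕ ∘′ lookup a) (toℕ-mod-id j) ⟨
      toℕ (lookup a (toℕ j mod n))    ≡⟨ a~f (toℕ j) ⟩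
      f (toℕ j) % m                   ≡⟨ f≈g (toℕ j) ⟩
      g (toℕ j) % m                   ≡⟨ b~g (toℕ j) ⟨
      toℕ (lookup b (toℕ j mod n))    ≡⟨ cong (toℕ ∘′ lookup b) (toℕ-mod-id j) ⟩
      toℕ (lookup b j)                ∎)
      where open ≡-Reasoning

  eventuallyPeriodic⇔Mod : ∀ {a f} → Represents a f → ∀ Q →
                           EventuallyPeriodicWith m n a Q ⇔ EventuallyPeriodicMod m Q f
  eventuallyPeriodic⇔Mod {a} {f} a~f Q = mk⇔
    (λ (N , per) → N , λ k N≤k → to (iterates-≡⇔≈ (k + Q) k) (per k N≤k))
    (λ (N , per) → N , λ k N≤k → from (iterates-≡⇔≈ (k + Q) k) (per k N≤k))
    where
    iterates-≡⇔≈ : ∀ k l → (iterT m n k a ≡ iterT m n l a) ⇔ (_≈_ m (iterStep k f) (iterStep l f))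
    iterates-≡⇔≈ k l = represents-≡⇔≈ (iterT-represents {a} {f} a~f k) (iterT-represents {a} {f} a~f l)

  seqOf : Vec (Fin m) n → ℕ → ℕ
  seqOf a i = toℕ (lookup a (i mod n))

  represents-seqOf : ∀ a → Represents a (seqOf a)
  represents-seqOf a i = sym (m<n⇒m%n≡m (toℕ<n _))

  seqOf-periodic : ∀ a → Periodic n (seqOf a)
  seqOf-periodic a i = cong (toℕ ∘′ lookup a) (toℕ-injective (trans (toℕ-mod _ n) (trans (m%n%n≡m%n i n) (sym (toℕ-mod i n)))))

  vecOf : (ℕ → ℕ) → Vec (Fin m) n
  vecOf f = tabulate (λ j → f (toℕ j) mod m)

  represents-vecOf : ∀ {f} → Periodic n f → Represents (vecOf f) f
  represents-vecOf {f} f-periodic i = begin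
    toℕ (lookup (vecOf f) (i mod n))  ≡⟨ cong toℕ (lookup∘tabulate _ (i mod n)) ⟩
    toℕ (f (toℕ (i mod n)) mod m)     ≡⟨ toℕ-mod _ m ⟩
    f (toℕ (i mod n)) % m             ≡⟨ cong (λ r → f r % m) (toℕ-mod i n) ⟩
    f (i % n) % m                     ≡⟨ cong (_% m) (f-periodic i) ⟩
    f i % m                           ∎
    where open ≡-Reasoning

  encode : Vec (Fin m) n → Fin (m ^ n)
  encode v = funToFin (lookup v)

  encode-injective : ∀ {u v} → encode u ≡ encode v → u ≡ v
  encode-injective {u} {v} eq = lookup-extensional λ j →
    trans (sym (finToFun-funToFin (lookup u) j)) (trans (cong (λ c → finToFun c j) eq) (finToFun-funToFin (lookup v) j))

  orbit-repeats : ∀ a → ∃₂ λ N Q → 0 < Q × iterT m n (N + Q) a ≡ iterT m n N a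
  orbit-repeats a with i , j , i<j , same-code ← pigeonhole (n<1+n (m ^ n)) (λ k → encode (iterT m n (toℕ k) a)) =
    toℕ i , toℕ j ∸ toℕ i , m<n⇒0<n∸m i<j ,
    trans (cong (λ k → iterT m n k a) (m+[n∸m]≡n (<⇒≤ i<j))) (sym (encode-injective same-code))

  cycleLength-exists : ∀ a → ∃ (IsCycleLength m n a)
  cycleLength-exists a with N , Q , 0<Q , repeat ← orbit-repeats a =
    leastPeriod-exists (T m n) (λ k → iterT m n k a) (λ _ → refl) (≡-dec _≟ᶠ_) {N} 0<Q repeat

  lastUnitVector : Vec (Fin m) n
  lastUnitVector = vecOf (δ n (pred n))

  lastUnitVector-universal : ∀ {Q} → EventuallyPeriodicWith m n lastUnitVector Q →
                             ∀ v → EventuallyPeriodicWith m n v Q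
  lastUnitVector-universal {Q} per v =
    from (eventuallyPeriodic⇔Mod (represents-seqOf v) Q)
      (δ-last-universal n m (to (eventuallyPeriodic⇔Mod (represents-vecOf (δ-periodic n (pred n))) Q) per)
        (seqOf-periodic v))

  period-universal : ∀ {q} → IsPeriod m n q → ∀ v → EventuallyPeriodicWith m n v q
  period-universal {q} ((b , cycle-b) , maximal) v =
    subst (EventuallyPeriodicWith m n v) R≡q (lastUnitVector-universal per-E v)
    where
    R : ℕ
    R = proj₁ (cycleLength-exists lastUnitVector)
    cycle-E : IsCycleLength m n lastUnitVector R
    cycle-E = proj₂ (cycleLength-exists lastUnitVector)
    per-E : EventuallyPeriodicWith m n lastUnitVector R
    per-E = proj₁ (proj₂ cycle-E)
    instance
      R≢0 : NonZero R
      R≢0 = >-nonZero (proj₁ cycle-E)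
    R≡q : R ≡ q
    R≡q = ≤-antisym (maximal lastUnitVector R cycle-E)
      (∣⇒≤ (leastPeriod∣period (λ k → iterT m n k b) cycle-b (lastUnitVector-universal per-E b)))

module _ (c d : ℕ) .{{_ : NonZero d}} .{{_ : NonZero (c * d)}} where

  private instance
    c≢0 : NonZero c
    c≢0 = m*n≢0⇒m≢0 c

  c*x%[c*d]≡x%d*c : ∀ x → (c * x) % (c * d) ≡ x % d * c
  c*x%[c*d]≡x%d*c x = begin
    (c * x) % (c * d) ≡⟨ %-congʳ (*-comm c d) ⟩
    (c * x) % (d * c) ≡⟨ cong (_% (d * c)) (*-comm c x) ⟩
    (x * c) % (d * c) ≡⟨ m%n*o≡m*o%[n*o] x d c ⟨
    x % d * c         ∎
    where
    open ≡-Reasoning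
    instance
      dc≢0 : NonZero (d * c)
      dc≢0 = m*n≢0 d c

  *-%-≡⇔ : ∀ x y → (c * x) % (c * d) ≡ (c * y) % (c * d) ⇔ x % d ≡ y % d
  *-%-≡⇔ x y = mk⇔
    (λ eq → *-cancelʳ-≡ _ _ c (trans (sym (c*x%[c*d]≡x%d*c x)) (trans eq (c*x%[c*d]≡x%d*c y))))
    (λ eq → trans (c*x%[c*d]≡x%d*c x) (trans (cong (_* c) eq) (sym (c*x%[c*d]≡x%d*c y))))

  eventuallyPeriodicMod-*ˡ⇔ : ∀ Q f → EventuallyPeriodicMod d Q f ⇔ EventuallyPeriodicMod (c * d) Q (λ i → c * f i)
  eventuallyPeriodicMod-*ˡ⇔ Q f = mk⇔
    (λ (N , per) → N , λ k N≤k i → from (iterates-≡⇔ (k + Q) k i) (per k N≤k i))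
    (λ (N , per) → N , λ k N≤k i → to (iterates-≡⇔ (k + Q) k i) (per k N≤k i))
    where
    iterates-≡⇔ : ∀ k l i → iterStep k (λ j → c * f j) i % (c * d) ≡ iterStep l (λ j → c * f j) i % (c * d)
                              ⇔ iterStep k f i % d ≡ iterStep l f i % d
    iterates-≡⇔ k l i rewrite iterStep-* k c f i | iterStep-* l c f i = *-%-≡⇔ _ _

  module _ (n : ℕ) .{{_ : NonZero n}} where

    scale : Vec (Fin d) n → Vec (Fin (c * d)) n
    scale a = vecOf (c * d) n (λ i → c * seqOf d n a i)

    cycleLength-scale : ∀ {a p} → IsCycleLength d n a p → IsCycleLength (c * d) n (scale a) p
    cycleLength-scale {a} = isLeastPositive-⇔ λ Q →
      ⇔-sym (eventuallyPeriodic⇔Mod (c * d) n (represents-vecOf (c * d) n scaled-periodic) Q)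
        ⇔-∘ (eventuallyPeriodicMod-*ˡ⇔ Q (seqOf d n a) ⇔-∘ eventuallyPeriodic⇔Mod d n (represents-seqOf d n a) Q)
      where
      scaled-periodic : Periodic n (λ i → c * seqOf d n a i)
      scaled-periodic i = cong (c *_) (seqOf-periodic d n a i)

proposition3p1 : (d m n : ℕ) .{{_ : NonZero d}} .{{_ : NonZero m}} .{{_ : NonZero n}} →
    d ∣ m → (p q : ℕ) → IsPeriod d n p → IsPeriod m n q → p ∣ q
proposition3p1 d .(c * d) n (divides c refl) p q ((a , cycle-a) , _) period-q =
  leastPeriod∣period (λ k → iterT (c * d) n k (scale c d n a)) (cycleLength-scale c d n cycle-a)
    (period-universal (c * d) n period-q (scale c d n a))
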